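{- Let $W = \{(x,y) \in \mathbb{Z}^2 : y - x^2 < 0\} \cup (\{0\} \times \mathbb{Z})$. Then the set $M = \{(t, -2t^2) : t \in \mathbb{Z}\}$ is a minimal complement of $W$ in $\mathbb{Z}^2$.
   Context: For an abelian group $G$ and nonempty subsets $W, W' \subseteq G$, $W'$ is a complement of $W$ in $G$ if $W + W' = G$; it is a minimal complement if moreover $W + (W' \setminus \{w'\}) \neq G$ for every $w' \in W'$. -}

module Defs where

open import Data.Integer using (ℤ; _+_; _-_; _*_; _<_; -_; +_)
open import Data.Product using (_×_; _,_; Σ; ∃; ∃-syntax)
open import Data.Sum using (_⊎_)
open import Relation.Binary.PropositionalEquality using (_≡_)
open import Relation.Nullary using (¬_)

ℤ² : Set
ℤ² = ℤ × ℤ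

_⊕_ : ℤ² → ℤ² → ℤ²
(a , b) ⊕ (c , d) = (a + c , b + d)

Subset : Set₁
Subset = ℤ² → Set

Nonempty : Subset → Set
Nonempty A = ∃[ a ] A a

InSum : Subset → Subset → ℤ² → Set
InSum A B g = ∃[ a ] ∃[ b ] (A a × B b × a ⊕ b ≡ g)

IsComplement : Subset → Subset → Set
IsComplement A B = ∀ g → InSum A B g

Remove : Subset → ℤ² → Subset
Remove B b x = B x × ¬ (x ≡ b)

IsMinimalComplement : Subset → Subset → Set
IsMinimalComplement A B =
  IsComplement A B × (∀ b → B b → ¬ IsComplement A (Remove B b))

W : Subset
W (x , y) = (y - x * x < + 0) ⊎ (x ≡ + 0)

M : Subset
M p = ∃[ t ] (p ≡ (t , - (+ 2 * (t * t))))

module Submission where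

-- Complement: every (a , b) splits as (0 , b + 2a²) + (a , -2a²), an
-- axis point of W plus a point of M.
--
-- Minimality: fix t₀ and the target g = (t₀ , 2t₀²).  If g = w + (t , -2t²)
-- then w is forced to be (t₀ - t , 2t₀² + 2t²), whose height above the
-- parabola y = x² is 2t₀² + 2t² - (t₀ - t)² = (t₀ + t)² ≥ 0.  So w cannot lie
-- strictly below the parabola and must lie on the axis, i.e. t = t₀.  Hence
-- the only point of M that reaches g is (t₀ , -2t₀²) itself, and removing it
-- from M leaves g uncovered.

open import Defs
open import Data.Product using (_×_; _,_)
open import Data.Sum using (inj₁; inj₂)
open import Data.Nat using (z≤n)
open import Data.Empty using (⊥-elim)
open import Data.Integer using (ℤ; _+_; _-_; _*_; _<_; _≤_; -_; +_; -[1+_]; +≤+; 0ℤ)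
open import Data.Integer.Properties using (pos-*; +-identityˡ; <-irrefl; ≤-<-trans; i-j≡0⇒i≡j)
open import Data.Integer.Tactic.RingSolver using (solve-∀)
open import Relation.Binary.PropositionalEquality using (_≡_; refl; sym; trans; cong; cong₂; subst)
open import Relation.Nullary using (¬_)

curve : ℤ → ℤ²
curve t = (t , - (+ 2 * (t * t)))

curve-in-M : ∀ t → M (curve t)
curve-in-M t = t , refl

-- Squares of integers are nonnegative; this is what keeps the forced summand
-- out of the region below the parabola.
square-nonneg : ∀ i → 0ℤ ≤ i * i
square-nonneg (+ n)    = subst (0ℤ ≤_) (pos-* n n) (+≤+ z≤n)
square-nonneg -[1+ n ] = +≤+ z≤n

complement : IsComplement W M
complement (a , b) =
  (+ 0 , b + + 2 * (a * a)) , curve a , inj₂ refl , curve-in-M a ,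
  cong₂ _,_ (+-identityˡ a) (lemma b a)
  where
  lemma : ∀ b a → b + + 2 * (a * a) + - (+ 2 * (a * a)) ≡ b
  lemma = solve-∀

-- The point that only curve t₀ can reach once W is added to M.
target : ℤ → ℤ²
target t₀ = (t₀ , + 2 * (t₀ * t₀))

cancel-curve : ∀ w t → w ≡ (w ⊕ curve t) ⊕ (- t , + 2 * (t * t))
cancel-curve (x , y) t = cong₂ _,_ (lemma₁ x t) (lemma₂ y t)
  where
  lemma₁ : ∀ x t → x ≡ x + t + - t
  lemma₁ = solve-∀
  lemma₂ : ∀ y t → y ≡ y + - (+ 2 * (t * t)) + + 2 * (t * t)
  lemma₂ = solve-∀

-- The summand of W needed to reach target t₀ from curve t.
forced-summand : ∀ t₀ t → ℤ²
forced-summand t₀ t = (t₀ - t , + 2 * (t₀ * t₀) + + 2 * (t * t))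

forced-summand-height : ∀ t₀ t →
  (+ 2 * (t₀ * t₀) + + 2 * (t * t)) - (t₀ - t) * (t₀ - t) ≡ (t₀ + t) * (t₀ + t)
forced-summand-height = solve-∀

-- The forced summand belongs to W only when t = t₀: it is never strictly
-- below the parabola, and it is on the axis exactly when t₀ - t = 0.
forced-summand-in-W : ∀ t₀ t → W (forced-summand t₀ t) → t ≡ t₀
forced-summand-in-W t₀ t (inj₁ below) =
  ⊥-elim (<-irrefl refl (≤-<-trans (square-nonneg (t₀ + t)) square-negative))
  where
  square-negative : (t₀ + t) * (t₀ + t) < 0ℤ
  square-negative = subst (_< 0ℤ) (forced-summand-height t₀ t) below
forced-summand-in-W t₀ t (inj₂ on-axis) = sym (i-j≡0⇒i≡j t₀ t on-axis)

unique-reach : ∀ w t₀ t → W w → w ⊕ curve t ≡ target t₀ → t ≡ t₀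
unique-reach w t₀ t w∈W reach = forced-summand-in-W t₀ t (subst W w-forced w∈W)
  where
  w-forced : w ≡ forced-summand t₀ t
  w-forced = trans (cancel-curve w t) (cong (_⊕ (- t , + 2 * (t * t))) reach)

minimal : ∀ m → M m → ¬ IsComplement W (Remove M m)
minimal _ (t₀ , refl) covers
  with covers (target t₀)
... | w , _ , w∈W , ((t , refl) , t≢t₀) , reach = t≢t₀ (cong curve (unique-reach w t₀ t w∈W reach))

corollary4p8 : Nonempty W × Nonempty M × IsMinimalComplement W M
corollary4p8 =
  ((+ 0 , + 0) , inj₂ refl) , (curve (+ 0) , curve-in-M (+ 0)) , complement , minimal
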